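{- Let $B=\{1324,14325,154326,1654327,\dots\}$ be the set of permutations of the form $1\,(m-1)(m-2)\cdots2\,m$ for $m\ge4$. If $w\in S_n$ consecutively contains one of the permutations in $B$, then $w$ is an Atniss win in $S_n$ (under the weak order).
   Context: The right weak order on $S_n$: $u\le v$ iff every inversion of $u$ (pair $i<j$ with $u^{ -1}(i)>u^{ -1}(j)$) is an inversion of $v$; this is a lattice. The standardization of a word of distinct positive integers of length $k$ is the permutation in $S_k$ obtained by replacing its $i$-th smallest entry by $i$. $w\in S_n$ consecutively contains $v\in S_k$ if for some $i\in[n-k+1]$ the standardization of $w(i)w(i+1)\cdots w(i+k-1)$ is $v$. An Ungar move sends $x$ to $\bigwedge(\{x\}\cup T)$ for a subset $T$ of the elements covered by $x$ (nontrivial if $T\ne\emptyset$); $\mathrm{Ung}(x)$ is the set of all results. In $S_n$, such a move reverses some disjoint consecutive decreasing subsequences of $x$. Recursively, the identity is an Eeta win, and $x$ is an Atniss win iff some element of $\mathrm{Ung}(x)\setminus\{x\}$ is an Eeta win, otherwise an Eeta win. -}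

module Defs where

open import Data.Nat as ℕ using (ℕ; zero; suc; _+_; _∸_; _≤_; _<?_)
open import Data.Fin as Fin using (Fin; toℕ)
open import Data.Fin.Permutation using (Permutation′; _⟨$⟩ʳ_; _⟨$⟩ˡ_)
open import Data.List using (List; length; filter; allFin)
open import Data.List.Relation.Unary.All using (All)
open import Data.Product using (Σ; _×_; ∃)
open import Data.Sum using (_⊎_)
open import Relation.Nullary using (¬_)
open import Relation.Binary.PropositionalEquality using (_≡_)

-- Permutations of [n] = {0,…,n-1} (0-based); w ⟨$⟩ʳ p is the value at position p,
-- w ⟨$⟩ˡ v is w⁻¹(v).
Perm : ℕ → Set
Perm = Permutation′

Inversion : ∀ {n} → Perm n → Fin n → Fin n → Set
Inversion u i j = (i Fin.< j) × ((u ⟨$⟩ˡ j) Fin.< (u ⟨$⟩ˡ i))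

-- right weak order: every inversion of u is an inversion of v
_≤W_ : ∀ {n} → Perm n → Perm n → Set
u ≤W v = ∀ i j → Inversion u i j → Inversion v i j

_≈P_ : ∀ {n} → Perm n → Perm n → Set
u ≈P v = ∀ p → u ⟨$⟩ʳ p ≡ v ⟨$⟩ʳ p

_⋖_ : ∀ {n} → Perm n → Perm n → Set
y ⋖ x = (y ≤W x) × ¬ (x ≤W y) × (∀ z → y ≤W z → z ≤W x → (z ≤W y) ⊎ (x ≤W z))

IsMeet : ∀ {n} → Perm n → List (Perm n) → Perm n → Set
IsMeet x T m =
  (m ≤W x) × All (m ≤W_) T × (∀ z → z ≤W x → All (z ≤W_) T → z ≤W m)

Ung : ∀ {n} → Perm n → Perm n → Set
Ung x y = Σ (List _) λ T → All (_⋖ x) T × IsMeet x T y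

Move : ∀ {n} → Perm n → Perm n → Set
Move x y = Ung x y × ¬ (y ≈P x)

-- Since moves strictly decrease in the weak order (a finite poset), the inductive
-- definition below determines the game value uniquely.
data AtnissWin {n} : Perm n → Set
data EetaWin {n} : Perm n → Set

data AtnissWin {n} where
  atniss : ∀ {x} y → Move x y → EetaWin y → AtnissWin x

data EetaWin {n} where
  eeta : ∀ {x} → (∀ y → Move x y → AtnissWin y) → EetaWin x

-- one-line notation as ℕ-valued word (0-based values); arbitrary outside [n]
word : ∀ {n} → Perm n → ℕ → ℕ
word {n} w p with p <? n
... | Relation.Nullary.yes p<n = toℕ (w ⟨$⟩ʳ Fin.fromℕ< p<n)
... | Relation.Nullary.no  _   = 0

-- 0-based standardization of the length-k factor of w starting at position i:
-- the entry at offset a becomes the number of entries of the factor smaller than it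
stdFactor : ∀ {n} → Perm n → (i k : ℕ) → Fin k → ℕ
stdFactor w i k a =
  length (filter (λ b → word w (i + toℕ b) <? word w (i + toℕ a)) (allFin k))

-- the pattern 1 (m-1) (m-2) ⋯ 2 m, written 0-based: 0 (m-2) (m-3) ⋯ 1 (m-1)
bPat : (m : ℕ) → Fin m → ℕ
bPat m a with toℕ a
... | zero = 0
... | suc p with suc p ℕ.≟ (m ∸ 1)
...   | Relation.Nullary.yes _ = m ∸ 1
...   | Relation.Nullary.no  _ = m ∸ 1 ∸ suc p

ConsContains : ∀ {n} → Perm n → (k : ℕ) → (Fin k → ℕ) → Set
ConsContains {n} w k v =
  Σ ℕ λ i → (i + k ≤ n) × (∀ a → stdFactor w i k a ≡ v a)

{-# OPTIONS --safe #-}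
-- Let the occurrence of 1 (m-1) ⋯ 2 m sit at positions i, …, i + m - 1 of w. Then w is decreasing on the
-- block B = [i + 1, i + m - 2] of length m - 2 ≥ 2, while w(i) < w(i + m - 2) and w(i + 1) < w(i + m - 1).
-- Reversing B is a move w ↦ p: p is the meet of w with the adjacent transpositions inside B, all of which
-- are covers of w. In p the block is increasing, and the two inequalities say that p has no descent at
-- either end of B; so every descent of p is a descent of w away from B, and every move from p (the meet of
-- p with transpositions at some of its descents) is also a move from w (add the transpositions inside B).
-- Strategy stealing: if p is an Eeta win, Atniss moves to p; otherwise p has a move to an Eeta win, and
-- Atniss makes that move from w. The game is determined because moves decrease the number of inversions
-- and all relations involved are decidable by running through the finite list of permutations.
module Submission where

open import Defs
open import Data.Nat as ℕ using (ℕ; zero; suc; _+_; _∸_; _≤_; _<_; z≤n; s≤s; _≤?_; _<?_)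
import Data.Nat.Properties as ℕP
open import Data.Fin as Fin using (Fin; toℕ; fromℕ<)
open import Data.Fin.Properties as FinP using (toℕ-injective; toℕ-fromℕ<; toℕ<n)
import Data.Fin.Permutation as P
open P using (_⟨$⟩ʳ_; _⟨$⟩ˡ_; inverseˡ; inverseʳ)
open import Data.List as List using (List; []; _∷_; filter; allFin; length; concatMap; map; _++_; cartesianProduct)
open import Data.List.Relation.Unary.All as All using (All; []; _∷_)
open import Data.List.Relation.Unary.Any as Any using (Any; here; there)
import Data.List.Relation.Unary.All.Properties as AllP
import Data.List.Relation.Unary.Any.Properties as AnyP
open import Data.List.Membership.Propositional using (_∈_; find; lose)
import Data.List.Membership.Propositional.Properties as MemP
import Data.List.Relation.Binary.Sublist.Propositional as Sub
import Data.List.Relation.Binary.Sublist.Propositional.Properties as SubP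
open import Data.Product as Prod using (Σ; _×_; _,_; proj₁; proj₂; ∃)
open import Data.Sum as Sum using (_⊎_; inj₁; inj₂)
open import Data.Empty using (⊥-elim)
open import Relation.Nullary using (¬_; Dec; yes; no)
open import Relation.Nullary.Decidable using (_×-dec_; _⊎-dec_; _→-dec_; ¬?; recompute)
open import Relation.Binary.PropositionalEquality using (_≡_; refl; sym; trans; cong; subst; subst₂)
open import Relation.Binary.Definitions using (Tri; tri<; tri≈; tri>)
open import Function using (_∘_; id; case_of_)
open import Induction.WellFounded using (Acc; acc)
open import Data.Nat.Induction using (<-wellFounded)

private variable n : ℕ

≈P-refl : (u : Perm n) → u ≈P u
≈P-refl u p = refl

≈P-sym : (u v : Perm n) → u ≈P v → v ≈P u
≈P-sym u v e p = sym (e p)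

≈P-trans : (u v w : Perm n) → u ≈P v → v ≈P w → u ≈P w
≈P-trans u v w e f p = trans (e p) (f p)

≈P⇒≡ˡ : (u v : Perm n) → u ≈P v → ∀ a → u ⟨$⟩ˡ a ≡ v ⟨$⟩ˡ a
≈P⇒≡ˡ u v e a = trans (sym (inverseˡ v)) (cong (v ⟨$⟩ˡ_) (trans (sym (e _)) (inverseʳ u)))

pos : Perm n → Fin n → ℕ
pos u a = toℕ (u ⟨$⟩ˡ a)

⟨$⟩ʳ-injective : (u : Perm n) → ∀ {s t} → u ⟨$⟩ʳ s ≡ u ⟨$⟩ʳ t → s ≡ t
⟨$⟩ʳ-injective u e = trans (sym (inverseˡ u)) (trans (cong (u ⟨$⟩ˡ_) e) (inverseˡ u))

⟨$⟩ˡ-injective : (u : Perm n) → ∀ {a b} → u ⟨$⟩ˡ a ≡ u ⟨$⟩ˡ b → a ≡ b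
⟨$⟩ˡ-injective u e = trans (sym (inverseʳ u)) (trans (cong (u ⟨$⟩ʳ_) e) (inverseʳ u))

Inversion-resp-≈P : (u v : Perm n) → u ≈P v → ∀ {a b} → Inversion u a b → Inversion v a b
Inversion-resp-≈P u v e {a} {b} (a<b , inv) =
  a<b , subst₂ Fin._<_ (≈P⇒≡ˡ u v e b) (≈P⇒≡ˡ u v e a) inv

≤W-refl : (u : Perm n) → u ≤W u
≤W-refl u a b i = i

≤W-trans : (u v w : Perm n) → u ≤W v → v ≤W w → u ≤W w
≤W-trans u v w uv vw a b i = vw a b (uv a b i)

≤W-resp-≈P : (u u′ v v′ : Perm n) → u ≈P u′ → v ≈P v′ → u ≤W v → u′ ≤W v′
≤W-resp-≈P u u′ v v′ eu ev uv a b i =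
  Inversion-resp-≈P v v′ ev (uv a b (Inversion-resp-≈P u′ u (≈P-sym u u′ eu) i))

Inversion? : (u : Perm n) → ∀ a b → Dec (Inversion u a b)
Inversion? u a b = (a Fin.<? b) ×-dec ((u ⟨$⟩ˡ b) Fin.<? (u ⟨$⟩ˡ a))

≤W? : (u v : Perm n) → Dec (u ≤W v)
≤W? u v = FinP.all? λ a → FinP.all? λ b → Inversion? u a b →-dec Inversion? v a b

≈P? : (u v : Perm n) → Dec (u ≈P v)
≈P? u v = FinP.all? λ p → (u ⟨$⟩ʳ p) FinP.≟ (v ⟨$⟩ʳ p)

¬≤W⇒∃Inversion : (u v : Perm n) → ¬ (u ≤W v) →
  ∃ λ a → ∃ λ b → Inversion u a b × ¬ Inversion v a b
¬≤W⇒∃Inversion {n} u v u≰v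
  with FinP.¬∀⟶∃¬ n _ (λ a → FinP.all? λ b → Inversion? u a b →-dec Inversion? v a b) u≰v
... | a , ¬a with FinP.¬∀⟶∃¬ n _ (λ b → Inversion? u a b →-dec Inversion? v a b) ¬a
...   | b , ¬ab with Inversion? u a b | Inversion? v a b
...     | yes iu | yes iv = ⊥-elim (¬ab λ _ → iv)
...     | yes iu | no ¬iv = a , b , iu , ¬iv
...     | no ¬iu | _      = ⊥-elim (¬ab λ iu → ⊥-elim (¬iu iu))

-- A permutation of [n + 1] is determined by its value at 0 and a permutation of [n].
allPerms : ∀ n → List (Perm n)
allPerms zero = P.id ∷ []
allPerms (suc n) = concatMap (λ j → map (P.insert Fin.zero j) (allPerms n)) (allFin (suc n))

insert-cong : ∀ (j : Fin (suc n)) (π ρ : Perm n) → π ≈P ρ →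
  P.insert Fin.zero j π ≈P P.insert Fin.zero j ρ
insert-cong j π ρ e Fin.zero = refl
insert-cong j π ρ e (Fin.suc k) =
  trans (P.insert-punchIn Fin.zero j π k)
    (trans (cong (Fin.punchIn j) (e k)) (sym (P.insert-punchIn Fin.zero j ρ k)))

allPerms-complete : ∀ n (π : Perm n) → Any (π ≈P_) (allPerms n)
allPerms-complete zero π = here λ ()
allPerms-complete (suc n) π =
  AnyP.concat⁺ (AnyP.map⁺ (lose (MemP.∈-allFin j) (AnyP.map⁺ (Any.map reinsert (allPerms-complete n π₀)))))
  where
  j = π ⟨$⟩ʳ Fin.zero
  π₀ = P.remove Fin.zero π
  reinsert : ∀ {ρ} → π₀ ≈P ρ → π ≈P P.insert Fin.zero j ρ
  reinsert {ρ} e = ≈P-trans π (P.insert Fin.zero j π₀) (P.insert Fin.zero j ρ)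
    (≈P-sym (P.insert Fin.zero j π₀) π (P.insert-remove Fin.zero π)) (insert-cong j π₀ ρ e)

representative : (π : Perm n) → ∃ λ ρ → ρ ∈ allPerms n × π ≈P ρ
representative {n} π = find (allPerms-complete n π)

all?-Perm : {Q : Perm n → Set} → (∀ z → Dec (Q z)) → (∀ z z′ → z ≈P z′ → Q z → Q z′) →
  Dec (∀ z → Q z)
all?-Perm {n} {Q} Q? resp with All.all? Q? (allPerms n)
... | no ¬all = no λ ∀Q → ¬all (All.tabulate λ {z} _ → ∀Q z)
... | yes all = yes λ z →
  let ρ , ρ∈ , z≈ρ = representative z in resp ρ z (≈P-sym z ρ z≈ρ) (All.lookup all ρ∈)

⋖-resp-≈P : (y y′ x x′ : Perm n) → y ≈P y′ → x ≈P x′ → y ⋖ x → y′ ⋖ x′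
⋖-resp-≈P y y′ x x′ ey ex (y≤x , x≰y , between) =
  ≤W-resp-≈P y y′ x x′ ey ex y≤x ,
  (λ x′≤y′ → x≰y (≤W-resp-≈P x′ x y′ y (≈P-sym x x′ ex) (≈P-sym y y′ ey) x′≤y′)) ,
  λ z y′≤z z≤x′ →
    Sum.map (≤W-resp-≈P z z y y′ (≈P-refl z) ey) (≤W-resp-≈P x x′ z z ex (≈P-refl z))
      (between z (≤W-resp-≈P y′ y z z (≈P-sym y y′ ey) (≈P-refl z) y′≤z)
                 (≤W-resp-≈P z z x′ x (≈P-refl z) (≈P-sym x x′ ex) z≤x′))

IsMeet-resp-≈P : (x x′ m m′ : Perm n) (T : List (Perm n)) → x ≈P x′ → m ≈P m′ →
  IsMeet x T m → IsMeet x′ T m′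
IsMeet-resp-≈P x x′ m m′ T ex em (m≤x , m≤T , greatest) =
  ≤W-resp-≈P m m′ x x′ em ex m≤x ,
  All.map (λ {t} → ≤W-resp-≈P m m′ t t em (≈P-refl t)) m≤T ,
  λ z z≤x′ z≤T →
    ≤W-resp-≈P z z m m′ (≈P-refl z) em
      (greatest z (≤W-resp-≈P z z x′ x (≈P-refl z) (≈P-sym x x′ ex) z≤x′) z≤T)

Move-resp-≈P : (x x′ y y′ : Perm n) → x ≈P x′ → y ≈P y′ → Move x y → Move x′ y′
Move-resp-≈P x x′ y y′ ex ey ((T , T⋖x , meet) , y≉x) =
  (T , All.map (λ {t} → ⋖-resp-≈P t t x x′ (≈P-refl t) ex) T⋖x , IsMeet-resp-≈P x x′ y y′ T ex ey meet) ,
  λ y′≈x′ → y≉x (≈P-trans y y′ x ey (≈P-trans y′ x′ x y′≈x′ (≈P-sym x x′ ex)))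

AtnissWin-resp-≈P : (x x′ : Perm n) → x ≈P x′ → AtnissWin x → AtnissWin x′
AtnissWin-resp-≈P x x′ e (atniss y mv ew) = atniss y (Move-resp-≈P x x′ y y e (≈P-refl y) mv) ew

⋖? : (y x : Perm n) → Dec (y ⋖ x)
⋖? y x = ≤W? y x ×-dec (¬? (≤W? x y) ×-dec all?-Perm between? resp)
  where
  between? : ∀ z → Dec (y ≤W z → z ≤W x → (z ≤W y) ⊎ (x ≤W z))
  between? z = ≤W? y z →-dec (≤W? z x →-dec (≤W? z y ⊎-dec ≤W? x z))
  resp : ∀ z z′ → z ≈P z′ → (y ≤W z → z ≤W x → (z ≤W y) ⊎ (x ≤W z)) →
    y ≤W z′ → z′ ≤W x → (z′ ≤W y) ⊎ (x ≤W z′)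
  resp z z′ e f y≤z′ z′≤x =
    Sum.map (≤W-resp-≈P z z′ y y e (≈P-refl y)) (≤W-resp-≈P x x z z′ (≈P-refl x) e)
      (f (≤W-resp-≈P y y z′ z (≈P-refl y) (≈P-sym z z′ e) y≤z′)
         (≤W-resp-≈P z′ z x x (≈P-sym z z′ e) (≈P-refl x) z′≤x))

IsMeet? : (x : Perm n) (T : List (Perm n)) (m : Perm n) → Dec (IsMeet x T m)
IsMeet? x T m = ≤W? m x ×-dec (All.all? (≤W? m) T ×-dec all?-Perm greatest? resp)
  where
  greatest? : ∀ z → Dec (z ≤W x → All (z ≤W_) T → z ≤W m)
  greatest? z = ≤W? z x →-dec (All.all? (≤W? z) T →-dec ≤W? z m)
  resp : ∀ z z′ → z ≈P z′ → (z ≤W x → All (z ≤W_) T → z ≤W m) →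
    z′ ≤W x → All (z′ ≤W_) T → z′ ≤W m
  resp z z′ e f z′≤x z′≤T =
    ≤W-resp-≈P z z′ m m e (≈P-refl m)
      (f (≤W-resp-≈P z′ z x x (≈P-sym z z′ e) (≈P-refl x) z′≤x)
         (All.map (λ {t} → ≤W-resp-≈P z′ z t t (≈P-sym z z′ e) (≈P-refl t)) z′≤T))

-- y ∈ Ung(x) iff y is the meet of x and all covers of x lying above y.
coversAbove : (x y : Perm n) → List (Perm n)
coversAbove {n} x y = filter (λ c → ⋖? c x ×-dec ≤W? y c) (allPerms n)

Ung? : (x y : Perm n) → Dec (Ung x y)
Ung? {n} x y with IsMeet? x (coversAbove x y) y
... | yes meet = yes (coversAbove x y , All.map proj₁ (AllP.all-filter _ (allPerms n)) , meet)
... | no ¬meet = no λ { (T , T⋖x , y≤x , y≤T , greatest) →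
  ¬meet (y≤x , All.map proj₂ (AllP.all-filter _ (allPerms n)) ,
         λ z z≤x z≤C → greatest z z≤x (All.tabulate λ {t} t∈T →
           below z z≤C t (All.lookup T⋖x t∈T) (All.lookup y≤T t∈T))) }
  where
  below : ∀ z → All (z ≤W_) (coversAbove x y) → ∀ t → t ⋖ x → y ≤W t → z ≤W t
  below z z≤C t t⋖x y≤t =
    let ρ , ρ∈ , t≈ρ = representative t
    in ≤W-resp-≈P z z ρ t (≈P-refl z) (≈P-sym t ρ t≈ρ)
         (All.lookup z≤C (MemP.∈-filter⁺ _ ρ∈
           (⋖-resp-≈P t ρ x x t≈ρ (≈P-refl x) t⋖x , ≤W-resp-≈P y y t ρ (≈P-refl y) t≈ρ y≤t)))

Move? : (x y : Perm n) → Dec (Move x y)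
Move? x y = Ung? x y ×-dec ¬? (≈P? y x)

module _ (g : Fin n → Fin n) (mono : ∀ s t → s Fin.< t → g s Fin.< g t) where
  private
    inflationary : ∀ k (s : Fin n) → toℕ s ≡ k → k ≤ toℕ (g s)
    inflationary zero s _ = z≤n
    inflationary (suc k) s e =
      ℕP.<-≤-trans (s≤s (inflationary k s′ (toℕ-fromℕ< k<n)))
        (mono s′ s (ℕP.≤-reflexive (trans (cong suc (toℕ-fromℕ< k<n)) (sym e))))
      where
      k<n : k < n
      k<n = ℕP.<-trans (ℕP.n<1+n k) (subst (_< n) e (toℕ<n s))
      s′ = fromℕ< k<n

    deflationary : ∀ d (s : Fin n) → suc (toℕ s) + d ≡ n → toℕ (g s) ≤ toℕ s
    deflationary zero s e = ℕP.≤-pred (subst (toℕ (g s) <_) (trans (sym e) (ℕP.+-identityʳ _)) (toℕ<n (g s)))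
    deflationary (suc d) s e =
      ℕP.≤-pred (ℕP.<-≤-trans (mono s s′ s<s′)
        (subst (toℕ (g s′) ≤_) (toℕ-fromℕ< 1+s<n) (deflationary d s′ e′)))
      where
      1+s<n : suc (toℕ s) < n
      1+s<n = subst (suc (toℕ s) <_) e (ℕP.m<m+n (suc (toℕ s)) (s≤s z≤n))
      s′ = fromℕ< 1+s<n
      s<s′ : s Fin.< s′
      s<s′ = ℕP.≤-reflexive (sym (toℕ-fromℕ< 1+s<n))
      e′ : suc (toℕ s′) + d ≡ n
      e′ = trans (cong (λ t → suc t + d) (toℕ-fromℕ< 1+s<n)) (trans (sym (ℕP.+-suc (suc (toℕ s)) d)) e)

  strictlyMonotone⇒≗id : ∀ s → g s ≡ s
  strictlyMonotone⇒≗id s = toℕ-injective (ℕP.≤-antisym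
    (deflationary (n ∸ suc (toℕ s)) s (ℕP.m+[n∸m]≡n (toℕ<n s)))
    (inflationary (toℕ s) s refl))

≤W-antisym : (u v : Perm n) → u ≤W v → v ≤W u → u ≈P v
≤W-antisym u v u≤v v≤u s =
  trans (cong (u ⟨$⟩ʳ_) (sym (strictlyMonotone⇒≗id (λ t → u ⟨$⟩ˡ (v ⟨$⟩ʳ t)) mono s))) (inverseʳ u)
  where
  sameOrder : ∀ a b → v ⟨$⟩ˡ a Fin.< v ⟨$⟩ˡ b → u ⟨$⟩ˡ a Fin.< u ⟨$⟩ˡ b
  sameOrder a b lt with FinP.<-cmp a b | FinP.<-cmp (u ⟨$⟩ˡ a) (u ⟨$⟩ˡ b)
  ... | _              | tri< r _ _  = r
  ... | tri> _ _ b<a   | _           = proj₂ (v≤u b a (b<a , lt))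
  ... | tri≈ _ refl _  | _           = ⊥-elim (ℕP.<-irrefl refl lt)
  ... | tri< a<b _ _   | tri≈ _ e _  = ⊥-elim (FinP.<-irrefl (⟨$⟩ˡ-injective u e) a<b)
  ... | tri< a<b _ _   | tri> _ _ gt = ⊥-elim (ℕP.<-asym lt (proj₂ (u≤v a b (a<b , gt))))
  mono : ∀ s t → s Fin.< t → u ⟨$⟩ˡ (v ⟨$⟩ʳ s) Fin.< u ⟨$⟩ˡ (v ⟨$⟩ʳ t)
  mono s t lt = sameOrder (v ⟨$⟩ʳ s) (v ⟨$⟩ʳ t) (subst₂ Fin._<_ (sym (inverseˡ v)) (sym (inverseˡ v)) lt)

module _ {A : Set} {P Q : A → Set} (P? : ∀ x → Dec (P x)) (Q? : ∀ x → Dec (Q x))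
         (P⇒Q : ∀ x → P x → Q x) where
  length-filter-mono : ∀ xs → length (filter P? xs) ≤ length (filter Q? xs)
  length-filter-mono xs =
    SubP.length-mono-≤ (SubP.filter⁺ P? Q? (λ { refl → P⇒Q _ }) (Sub.⊆-reflexive (refl {x = xs})))

  length-filter-strict : ∀ {x} xs → x ∈ xs → Q x → ¬ P x →
    length (filter P? xs) < length (filter Q? xs)
  length-filter-strict (y ∷ xs) (here refl) q ¬p with P? y | Q? y
  ... | yes p | _     = ⊥-elim (¬p p)
  ... | no _  | no ¬q = ⊥-elim (¬q q)
  ... | no _  | yes _ = s≤s (length-filter-mono xs)
  length-filter-strict (y ∷ xs) (there x∈xs) q ¬p with P? y | Q? y
  ... | yes p | yes _ = s≤s (length-filter-strict xs x∈xs q ¬p)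
  ... | yes p | no ¬q = ⊥-elim (¬q (P⇒Q y p))
  ... | no _  | yes _ = ℕP.m≤n⇒m≤1+n (length-filter-strict xs x∈xs q ¬p)
  ... | no _  | no _  = length-filter-strict xs x∈xs q ¬p

#inversions : Perm n → ℕ
#inversions {n} u = length (filter (Prod.uncurry (Inversion? u)) (cartesianProduct (allFin n) (allFin n)))

<W⇒#inversions-< : (u v : Perm n) → u ≤W v → ¬ (v ≤W u) → #inversions u < #inversions v
<W⇒#inversions-< {n} u v u≤v v≰u =
  let a , b , iv , ¬iu = ¬≤W⇒∃Inversion v u v≰u
  in length-filter-strict (Prod.uncurry (Inversion? u)) (Prod.uncurry (Inversion? v)) (λ (a , b) → u≤v a b)
       (cartesianProduct (allFin n) (allFin n)) (MemP.∈-cartesianProduct⁺ (MemP.∈-allFin a) (MemP.∈-allFin b)) iv ¬iu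

Move⇒#inversions-< : (x y : Perm n) → Move x y → #inversions y < #inversions x
Move⇒#inversions-< x y ((_ , _ , y≤x , _) , y≉x) =
  <W⇒#inversions-< y x y≤x (λ x≤y → y≉x (≤W-antisym y x y≤x x≤y))

eetaMove-or-allAtniss : (x : Perm n) → (∀ y → Move x y → EetaWin y ⊎ AtnissWin y) →
  (ys : List (Perm n)) → (∃ λ y → Move x y × EetaWin y) ⊎ All (λ y → Move x y → AtnissWin y) ys
eetaMove-or-allAtniss x ih [] = inj₂ []
eetaMove-or-allAtniss x ih (y ∷ ys) with Move? x y
... | no ¬mv = Sum.map₂ ((λ mv → ⊥-elim (¬mv mv)) ∷_) (eetaMove-or-allAtniss x ih ys)
... | yes mv with ih y mv
...   | inj₁ y-eeta = inj₁ (y , mv , y-eeta)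
...   | inj₂ at   = Sum.map₂ ((λ _ → at) ∷_) (eetaMove-or-allAtniss x ih ys)

determined-step : (x : Perm n) →
  (∃ λ y → Move x y × EetaWin y) ⊎ All (λ y → Move x y → AtnissWin y) (allPerms n) →
  EetaWin x ⊎ AtnissWin x
determined-step x (inj₁ (y , mv , y-eeta)) = inj₂ (atniss y mv y-eeta)
determined-step x (inj₂ allAtniss) = inj₁ (eeta λ y mv →
    let ρ , ρ∈ , y≈ρ = representative y
    in AtnissWin-resp-≈P ρ y (≈P-sym y ρ y≈ρ)
         (All.lookup allAtniss ρ∈ (Move-resp-≈P x x y ρ (≈P-refl x) y≈ρ mv)))

determined : (x : Perm n) → EetaWin x ⊎ AtnissWin x
determined {n} x = go x (<-wellFounded (#inversions x))
  where
  go : (x : Perm n) → Acc _<_ (#inversions x) → EetaWin x ⊎ AtnissWin x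
  go x (acc rs) =
    determined-step x (eetaMove-or-allAtniss x (λ y mv → go y (rs (Move⇒#inversions-< x y mv))) (allPerms n))

strategy-stealing : (w p : Perm n) → Move w p → (∀ y → Move p y → Move w y) → AtnissWin w
strategy-stealing w p w↦p steal = Sum.[ atniss p w↦p , stealReply ]′ (determined p)
  where
  stealReply : AtnissWin p → AtnissWin w
  stealReply (atniss y p↦y y-eeta) = atniss y (steal y p↦y) y-eeta

module BlockReversal {n : ℕ} (lo L : ℕ) .(hi<n : lo + L < n) where
  hi : ℕ
  hi = lo + L

  InBlock : ℕ → Set
  InBlock s = (lo ≤ s) × (s ≤ hi)

  InBlock? : ∀ s → Dec (InBlock s)
  InBlock? s = (lo ≤? s) ×-dec (s ≤? hi)

  reflect : ℕ → ℕ
  reflect s with InBlock? s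
  ... | yes _ = (lo + hi) ∸ s
  ... | no _  = s

  reflect-inside : ∀ {s} → InBlock s → reflect s ≡ (lo + hi) ∸ s
  reflect-inside {s} b with InBlock? s
  ... | yes _ = refl
  ... | no ¬b = ⊥-elim (¬b b)

  reflect-outside : ∀ {s} → ¬ InBlock s → reflect s ≡ s
  reflect-outside {s} ¬b with InBlock? s
  ... | yes b = ⊥-elim (¬b b)
  ... | no _  = refl

  reflect-lo : reflect lo ≡ hi
  reflect-lo = trans (reflect-inside (ℕP.≤-refl , ℕP.m≤m+n lo L)) (ℕP.m+n∸m≡n lo hi)

  reflect-hi : reflect hi ≡ lo
  reflect-hi = trans (reflect-inside (ℕP.m≤m+n lo L , ℕP.≤-refl)) (ℕP.m+n∸n≡m lo hi)

  private
    sum∸-InBlock : ∀ {s} → InBlock s → InBlock ((lo + hi) ∸ s)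
    sum∸-InBlock {s} (lo≤s , s≤hi) =
      subst (_≤ (lo + hi) ∸ s) (ℕP.m+n∸n≡m lo hi) (ℕP.∸-monoʳ-≤ (lo + hi) s≤hi) ,
      subst ((lo + hi) ∸ s ≤_) (ℕP.m+n∸m≡n lo hi) (ℕP.∸-monoʳ-≤ (lo + hi) lo≤s)

  reflect-InBlock : ∀ {s} → InBlock s → InBlock (reflect s)
  reflect-InBlock b = subst InBlock (sym (reflect-inside b)) (sum∸-InBlock b)

  reflect-involutive : ∀ s → reflect (reflect s) ≡ s
  reflect-involutive s with InBlock? s
  ... | no ¬b = reflect-outside ¬b
  ... | yes b = trans (reflect-inside (sum∸-InBlock b))
                      (ℕP.m∸[m∸n]≡n (ℕP.≤-trans (proj₂ b) (ℕP.m≤n+m hi lo)))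

  reflect-< : ∀ {s} → s < n → reflect s < n
  reflect-< {s} s<n with InBlock? s
  ... | no _  = s<n
  ... | yes b = ℕP.≤-<-trans (proj₂ (sum∸-InBlock b)) (recompute (hi <? n) hi<n)

  reflect-antitone-inside : ∀ {s t} → InBlock s → InBlock t → t < s → reflect s < reflect t
  reflect-antitone-inside bs bt t<s = subst₂ _<_ (sym (reflect-inside bs)) (sym (reflect-inside bt))
    (ℕP.∸-monoʳ-< t<s (ℕP.≤-trans (proj₂ bs) (ℕP.m≤n+m hi lo)))

  reflect-monotone-outside : ∀ {s t} → ¬ (InBlock s × InBlock t) → s < t → reflect s < reflect t
  reflect-monotone-outside {s} {t} ¬both s<t with InBlock? s | InBlock? t
  ... | yes bs | yes bt = ⊥-elim (¬both (bs , bt))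
  ... | yes bs | no ¬bt =
    ℕP.≤-<-trans (proj₂ (sum∸-InBlock bs))
      (ℕP.≰⇒> λ t≤hi → ¬bt (ℕP.≤-trans (proj₁ bs) (ℕP.<⇒≤ s<t) , t≤hi))
  ... | no ¬bs | yes bt =
    ℕP.<-≤-trans (ℕP.≰⇒> λ lo≤s → ¬bs (lo≤s , ℕP.≤-trans (ℕP.<⇒≤ s<t) (proj₂ bt)))
      (proj₁ (sum∸-InBlock bt))
  ... | no _   | no _   = s<t

  reflect-antitone-inside⁻ : ∀ {s t} → InBlock s → InBlock t → reflect s < reflect t → t < s
  reflect-antitone-inside⁻ {s} {t} bs bt lt with ℕP.<-cmp t s
  ... | tri< t<s _ _  = t<s
  ... | tri≈ _ refl _ = ⊥-elim (ℕP.<-irrefl refl lt)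
  ... | tri> _ _ s<t  = ⊥-elim (ℕP.<-asym lt (reflect-antitone-inside bt bs s<t))

  reflect-monotone-outside⁻ : ∀ {s t} → ¬ (InBlock s × InBlock t) → reflect s < reflect t → s < t
  reflect-monotone-outside⁻ {s} {t} ¬both lt with ℕP.<-cmp s t
  ... | tri< s<t _ _  = s<t
  ... | tri≈ _ refl _ = ⊥-elim (ℕP.<-irrefl refl lt)
  ... | tri> _ _ t<s  = ⊥-elim (ℕP.<-asym lt (reflect-monotone-outside (¬both ∘ Prod.swap) t<s))

  reflectFin : Fin n → Fin n
  reflectFin s = fromℕ< (reflect-< (toℕ<n s))

  toℕ-reflectFin : ∀ s → toℕ (reflectFin s) ≡ reflect (toℕ s)
  toℕ-reflectFin s = toℕ-fromℕ< (reflect-< (toℕ<n s))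

  reflectFin-involutive : ∀ s → reflectFin (reflectFin s) ≡ s
  reflectFin-involutive s = toℕ-injective (trans (toℕ-reflectFin (reflectFin s))
    (trans (cong reflect (toℕ-reflectFin s)) (reflect-involutive (toℕ s))))

  reverseBlock : Perm n → Perm n
  reverseBlock w = P.permutation (λ s → w ⟨$⟩ʳ reflectFin s) (λ a → reflectFin (w ⟨$⟩ˡ a))
    (λ a → trans (cong (w ⟨$⟩ʳ_) (reflectFin-involutive _)) (inverseʳ w))
    (λ s → trans (cong reflectFin (inverseˡ w)) (reflectFin-involutive s))

  module _ (w : Perm n) where
    BothInBlock : Fin n → Fin n → Set
    BothInBlock a b = InBlock (pos w a) × InBlock (pos w b)

    BothInBlock? : ∀ a b → Dec (BothInBlock a b)
    BothInBlock? a b = InBlock? (pos w a) ×-dec InBlock? (pos w b)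

    DecreasingOnBlock : Set
    DecreasingOnBlock = ∀ (s t : Fin n) → InBlock (toℕ s) → InBlock (toℕ t) → s Fin.< t →
      w ⟨$⟩ʳ t Fin.< w ⟨$⟩ʳ s

    pos-reverseBlock : ∀ a → pos (reverseBlock w) a ≡ reflect (pos w a)
    pos-reverseBlock a = toℕ-reflectFin (w ⟨$⟩ˡ a)

    reverseBlock-inversion-outside⁻ : ∀ {a b} → ¬ BothInBlock a b →
      Inversion (reverseBlock w) a b → Inversion w a b
    reverseBlock-inversion-outside⁻ {a} {b} ¬ab (a<b , inv) = a<b ,
      reflect-monotone-outside⁻ (¬ab ∘ Prod.swap) (subst₂ _<_ (pos-reverseBlock b) (pos-reverseBlock a) inv)

    reverseBlock-inversion-outside⁺ : ∀ {a b} → ¬ BothInBlock a b →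
      Inversion w a b → Inversion (reverseBlock w) a b
    reverseBlock-inversion-outside⁺ {a} {b} ¬ab (a<b , inv) = a<b ,
      subst₂ _<_ (sym (pos-reverseBlock b)) (sym (pos-reverseBlock a)) (reflect-monotone-outside (¬ab ∘ Prod.swap) inv)

    reverseBlock-inversion-inside⁻ : ∀ {a b} → BothInBlock a b →
      Inversion (reverseBlock w) a b → pos w a < pos w b
    reverseBlock-inversion-inside⁻ {a} {b} (ia , ib) (_ , inv) =
      reflect-antitone-inside⁻ ib ia (subst₂ _<_ (pos-reverseBlock b) (pos-reverseBlock a) inv)

    reverseBlock-inversion⁻ : DecreasingOnBlock → ∀ {a b} →
      Inversion (reverseBlock w) a b → Inversion w a b × ¬ BothInBlock a b
    reverseBlock-inversion⁻ dec {a} {b} inv with BothInBlock? a b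
    ... | no ¬ab = reverseBlock-inversion-outside⁻ ¬ab inv , ¬ab
    ... | yes ab@(ia , ib) = ⊥-elim (ℕP.<-asym (proj₁ inv)
      (subst₂ Fin._<_ (inverseʳ w) (inverseʳ w)
        (dec (w ⟨$⟩ˡ a) (w ⟨$⟩ˡ b) ia ib (reverseBlock-inversion-inside⁻ ab inv))))

    reverseBlock-≤W : DecreasingOnBlock → reverseBlock w ≤W w
    reverseBlock-≤W dec a b inv = proj₁ (reverseBlock-inversion⁻ dec inv)

<-within-adjacent : ∀ {r x y} → r ≤ x → y ≤ r + 1 → x < y → (x ≡ r) × (y ≡ suc r)
<-within-adjacent {r} {x} {y} r≤x y≤r+1 x<y =
  let y≤1+r = subst (y ≤_) (ℕP.+-comm r 1) y≤r+1
      x≡r = ℕP.≤-antisym (ℕP.≤-pred (ℕP.<-≤-trans x<y y≤1+r)) r≤x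
  in x≡r , ℕP.≤-antisym y≤1+r (subst (λ z → suc z ≤ y) x≡r x<y)

-- The transposition of positions r and r + 1 is the reversal of the block [r, r + 1].
module AdjacentSwap {n : ℕ} (w : Perm n) (r : ℕ) .(r+1<n : suc r < n) where
  open BlockReversal {n} r 1 (subst (_< n) (ℕP.+-comm 1 r) r+1<n) public

  r<n : r < n
  r<n = recompute (r <? n) (ℕP.<-trans (ℕP.n<1+n r) r+1<n)

  w[r] w[r+1] : Fin n
  w[r] = w ⟨$⟩ʳ fromℕ< r<n
  w[r+1] = w ⟨$⟩ʳ fromℕ< r+1<n

  swap : Perm n
  swap = reverseBlock w

  Descent : Set
  Descent = w[r+1] Fin.< w[r]

  pos-w[r] : pos w w[r] ≡ r
  pos-w[r] = trans (cong toℕ (inverseˡ w)) (toℕ-fromℕ< r<n)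

  pos-w[r+1] : pos w w[r+1] ≡ suc r
  pos-w[r+1] = trans (cong toℕ (inverseˡ w)) (toℕ-fromℕ< r+1<n)

  descent-BothInBlock : BothInBlock w w[r+1] w[r]
  descent-BothInBlock =
    subst InBlock (sym pos-w[r+1]) (ℕP.n≤1+n r , ℕP.≤-reflexive (ℕP.+-comm 1 r)) ,
    subst InBlock (sym pos-w[r]) (ℕP.≤-refl , ℕP.m≤m+n r 1)

  inversion-inBlock-unique : ∀ {a b} → BothInBlock w a b → Inversion w a b → (a ≡ w[r+1]) × (b ≡ w[r])
  inversion-inBlock-unique {a} {b} (ia , ib) (_ , inv) =
    let pb≡r , pa≡1+r = <-within-adjacent (proj₁ ib) (proj₂ ia) inv
        at : ∀ c {s} .(s<n : s < n) → pos w c ≡ s → c ≡ w ⟨$⟩ʳ fromℕ< s<n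
        at c s<n e = trans (sym (inverseʳ w)) (cong (w ⟨$⟩ʳ_) (toℕ-injective (trans e (sym (toℕ-fromℕ< s<n)))))
    in at a r+1<n pa≡1+r , at b r<n pb≡r

  DescentKeptIn : Perm n → Set
  DescentKeptIn c = Descent × pos c w[r+1] < pos c w[r]

  module _ (desc : Descent) where
    decreasingOnBlock : DecreasingOnBlock w
    decreasingOnBlock s t is it s<t =
      let s≡r , t≡1+r = <-within-adjacent (proj₁ is) (proj₂ it) s<t
      in subst₂ (λ t′ s′ → w ⟨$⟩ʳ t′ Fin.< w ⟨$⟩ʳ s′)
           (toℕ-injective (trans (toℕ-fromℕ< r+1<n) (sym t≡1+r)))
           (toℕ-injective (trans (toℕ-fromℕ< r<n) (sym s≡r))) desc

    descent-inversion : Inversion w w[r+1] w[r]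
    descent-inversion = desc , subst₂ _<_ (sym pos-w[r]) (sym pos-w[r+1]) (ℕP.n<1+n r)

    ≤W-swap⇒¬inversion : ∀ z → z ≤W swap → ¬ Inversion z w[r+1] w[r]
    ≤W-swap⇒¬inversion z z≤swap iz =
      proj₂ (reverseBlock-inversion⁻ w decreasingOnBlock (z≤swap _ _ iz)) descent-BothInBlock

    ≤W-swap : ∀ z → z ≤W w → ¬ Inversion z w[r+1] w[r] → z ≤W swap
    ≤W-swap z z≤w ¬iz a b iab with BothInBlock? w a b
    ... | no ¬ab = reverseBlock-inversion-outside⁺ w ¬ab (z≤w a b iab)
    ... | yes ab with inversion-inBlock-unique ab (z≤w a b iab)
    ...   | refl , refl = ⊥-elim (¬iz iab)

    swap-⋖ : swap ⋖ w
    swap-⋖ = reverseBlock-≤W w decreasingOnBlock ,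
             (λ w≤swap → ≤W-swap⇒¬inversion w w≤swap descent-inversion) ,
             between
      where
      between : ∀ z → swap ≤W z → z ≤W w → (z ≤W swap) ⊎ (w ≤W z)
      between z swap≤z z≤w with Inversion? z w[r+1] w[r]
      ... | no ¬iz = inj₁ (≤W-swap z z≤w ¬iz)
      ... | yes iz = inj₂ λ a b iab → case BothInBlock? w a b of λ where
        (no ¬ab) → swap≤z a b (reverseBlock-inversion-outside⁺ w ¬ab iab)
        (yes ab) → subst₂ (Inversion z) (sym (proj₁ (inversion-inBlock-unique ab iab)))
                                        (sym (proj₂ (inversion-inBlock-unique ab iab))) iz

¬Inversion⇒pos-< : (c : Perm n) → ∀ {a b} → a Fin.< b → ¬ Inversion c a b → pos c a < pos c b
¬Inversion⇒pos-< c {a} {b} a<b ¬inv with ℕP.<-cmp (pos c a) (pos c b)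
... | tri< lt _ _ = lt
... | tri≈ _ e _  = ⊥-elim (FinP.<-irrefl (⟨$⟩ˡ-injective c (toℕ-injective e)) a<b)
... | tri> _ _ gt = ⊥-elim (¬inv (a<b , gt))

≤W-reorder⇒> : (c x : Perm n) → c ≤W x → ∀ {a b} → pos x a < pos x b → pos c b < pos c a → b Fin.< a
≤W-reorder⇒> c x c≤x {a} {b} x-ab c-ba with FinP.<-cmp a b
... | tri< a<b _ _  = ⊥-elim (ℕP.<-asym x-ab (proj₂ (c≤x a b (a<b , c-ba))))
... | tri≈ _ refl _ = ⊥-elim (ℕP.<-irrefl refl x-ab)
... | tri> _ _ b<a  = b<a

next-position : ∀ k (s t : Fin n) → toℕ t ≡ suc (toℕ s + suc k) →
  ∃ λ u → (toℕ u ≡ suc (toℕ s)) × (toℕ t ≡ suc (toℕ u + k))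
next-position {n} k s t t≡ =
  u , toℕ-u , trans t≡ (cong suc (trans (ℕP.+-suc (toℕ s) k) (cong (_+ k) (sym toℕ-u))))
  where
  u<n : suc (toℕ s) < n
  u<n = ℕP.≤-<-trans (subst (suc (toℕ s) ≤_) (sym t≡) (s≤s (ℕP.m≤m+n (toℕ s) (suc k)))) (toℕ<n t)
  u = fromℕ< u<n
  toℕ-u : toℕ u ≡ suc (toℕ s)
  toℕ-u = toℕ-fromℕ< u<n

next-position-< : ∀ (u t : Fin n) k → toℕ t ≡ suc (toℕ u + k) → toℕ u < toℕ t
next-position-< u t k t≡ = subst (toℕ u <_) (sym t≡) (s≤s (ℕP.m≤m+n (toℕ u) k))

module _ (x c : Perm n) (c≤x : c ≤W x) where
  KeptDescent : Set
  KeptDescent = ∃ λ r → Σ (suc r < n) λ r+1<n → AdjacentSwap.DescentKeptIn x r r+1<n c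

  private
    keptDescent-adjacent : (s t : Fin n) → toℕ t ≡ suc (toℕ s) → x ⟨$⟩ʳ t Fin.< x ⟨$⟩ʳ s →
      pos c (x ⟨$⟩ʳ t) < pos c (x ⟨$⟩ʳ s) → KeptDescent
    keptDescent-adjacent s t t≡1+s desc kept =
      toℕ s , s+1<n ,
      subst₂ (λ s′ t′ → (x ⟨$⟩ʳ t′ Fin.< x ⟨$⟩ʳ s′) × pos c (x ⟨$⟩ʳ t′) < pos c (x ⟨$⟩ʳ s′))
        (sym (FinP.fromℕ<-toℕ s (toℕ<n s))) (toℕ-injective (trans t≡1+s (sym (toℕ-fromℕ< s+1<n))))
        (desc , kept)
      where
      s+1<n : suc (toℕ s) < n
      s+1<n = subst (_< n) t≡1+s (toℕ<n t)

  -- Walk from s towards t: the entry right after s is either a kept descent with s, or can replace s.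
  keptDescent : ∀ k (s t : Fin n) → toℕ t ≡ suc (toℕ s + k) → x ⟨$⟩ʳ t Fin.< x ⟨$⟩ʳ s →
    pos c (x ⟨$⟩ʳ t) < pos c (x ⟨$⟩ʳ s) → KeptDescent
  keptDescent zero s t t≡ desc kept =
    keptDescent-adjacent s t (trans t≡ (cong suc (ℕP.+-identityʳ _))) desc kept
  keptDescent (suc k) s t t≡ desc kept with next-position k s t t≡
  ... | u , toℕ-u , t≡′ = continue (ℕP.<-cmp (pos c X) (pos c (x ⟨$⟩ʳ s)))
    where
    X = x ⟨$⟩ʳ u
    pos-x : ∀ p → pos x (x ⟨$⟩ʳ p) ≡ toℕ p
    pos-x p = cong toℕ (inverseˡ x)
    s<u : pos x (x ⟨$⟩ʳ s) < pos x X
    s<u = subst₂ _<_ (sym (pos-x s)) (sym (trans (pos-x u) toℕ-u)) (ℕP.n<1+n (toℕ s))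
    u<t : pos x X < pos x (x ⟨$⟩ʳ t)
    u<t = subst₂ _<_ (sym (pos-x u)) (sym (pos-x t)) (next-position-< u t k t≡′)
    continue : Tri (pos c X < pos c (x ⟨$⟩ʳ s)) (pos c X ≡ pos c (x ⟨$⟩ʳ s)) (pos c (x ⟨$⟩ʳ s) < pos c X) →
      KeptDescent
    continue (tri< cX<cs _ _) = keptDescent-adjacent s u toℕ-u (≤W-reorder⇒> c x c≤x s<u cX<cs) cX<cs
    continue (tri≈ _ e _) =
      ⊥-elim (ℕP.1+n≢n (trans (sym toℕ-u)
        (cong toℕ (⟨$⟩ʳ-injective x (⟨$⟩ˡ-injective c (toℕ-injective e))))))
    continue (tri> _ _ cs<cX) =
      let ct<cX = ℕP.<-trans kept cs<cX
      in keptDescent k u t t≡′ (≤W-reorder⇒> c x c≤x u<t ct<cX) ct<cX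

⋖⇒swap : (c x : Perm n) → c ⋖ x → ∃ λ r → Σ (suc r < n) λ r+1<n →
  let open AdjacentSwap x r r+1<n in Descent × (c ≤W swap) × (swap ≤W c)
⋖⇒swap c x (c≤x , x≰c , between) with ¬≤W⇒∃Inversion x c x≰c
... | a , b , (a<b , xb<xa) , ¬ic with keptDescent x c c≤x (pos x a ∸ suc (pos x b)) (x ⟨$⟩ˡ b) (x ⟨$⟩ˡ a)
      (sym (ℕP.m+[n∸m]≡n xb<xa)) (subst₂ Fin._<_ (sym (inverseʳ x)) (sym (inverseʳ x)) a<b)
      (subst₂ (λ a′ b′ → pos c a′ < pos c b′) (sym (inverseʳ x)) (sym (inverseʳ x))
        (¬Inversion⇒pos-< c a<b ¬ic))
... | r , r+1<n , desc , kept = r , r+1<n , desc , c≤swap , swap≤c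
  where
  open AdjacentSwap x r r+1<n
  c≤swap : c ≤W swap
  c≤swap = ≤W-swap desc c c≤x (λ inv → ℕP.<-asym kept (proj₂ inv))
  swap≤c : swap ≤W c
  swap≤c = Sum.[ id , (λ x≤swap → ⊥-elim (proj₁ (proj₂ (swap-⋖ desc)) x≤swap)) ]′
             (between swap c≤swap (proj₁ (swap-⋖ desc)))

CoverPartner : (w p c : Perm n) → Set
CoverPartner w p c = ∃ λ q → q ⋖ w × c ≤W q × (∀ z → z ≤W p → z ≤W q → z ≤W c)

moves-lift : (w p : Perm n) (T : List (Perm n)) → All (_⋖ w) T → IsMeet w T p → ¬ (w ≤W p) →
  (∀ c → c ⋖ p → CoverPartner w p c) → ∀ y → Move p y → Move w y
moves-lift {n} w p T T⋖w (p≤w , p≤T , p-greatest) w≰p partner y ((C , C⋖p , y≤p , y≤C , y-greatest) , _) =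
  (T ++ Q , AllP.++⁺ T⋖w Q⋖w ,
   ≤W-trans y p w y≤p p≤w ,
   AllP.++⁺ (All.map (λ {t} → ≤W-trans y p t y≤p) p≤T) (y≤Q y≤C) ,
   λ z z≤w z≤TQ →
     let z≤p = p-greatest z z≤w (AllP.++⁻ˡ T z≤TQ)
     in y-greatest z z≤p (Q⇒C z z≤p (AllP.++⁻ʳ T z≤TQ))) ,
  λ y≈w → w≰p (≤W-resp-≈P y w p p y≈w (≈P-refl p) y≤p)
  where
  partners : ∀ C → All (_⋖ p) C → Σ (List (Perm n)) λ Q → All (_⋖ w) Q ×
    (All (y ≤W_) C → All (y ≤W_) Q) × (∀ z → z ≤W p → All (z ≤W_) Q → All (z ≤W_) C)
  partners [] [] = [] , [] , (λ _ → []) , (λ _ _ _ → [])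
  partners (c ∷ C) (c⋖p ∷ C⋖p) =
    let q , q⋖w , c≤q , q⇒c = partner c c⋖p
        Q , Q⋖w , C⇒Q , Q⇒C = partners C C⋖p
    in q ∷ Q , q⋖w ∷ Q⋖w ,
       (λ { (y≤c ∷ y≤C) → ≤W-trans y c q y≤c c≤q ∷ C⇒Q y≤C }) ,
       (λ { z z≤p (z≤q ∷ z≤Q) → q⇒c z z≤p z≤q ∷ Q⇒C z z≤p z≤Q })
  Q = proj₁ (partners C C⋖p)
  Q⋖w = proj₁ (proj₂ (partners C C⋖p))
  y≤Q = proj₁ (proj₂ (proj₂ (partners C C⋖p)))
  Q⇒C = proj₂ (proj₂ (proj₂ (partners C C⋖p)))

decreasing-by-adjacent : (f : Fin n → ℕ) (lo hi : ℕ) →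
  (∀ s t → lo ≤ toℕ s → toℕ t ≤ hi → toℕ t ≡ suc (toℕ s) → f t < f s) →
  ∀ k s t → lo ≤ toℕ s → toℕ t ≤ hi → toℕ t ≡ suc (toℕ s + k) → f t < f s
decreasing-by-adjacent f lo hi step zero s t lo≤s t≤hi t≡ =
  step s t lo≤s t≤hi (trans t≡ (cong suc (ℕP.+-identityʳ _)))
decreasing-by-adjacent f lo hi step (suc k) s t lo≤s t≤hi t≡ with next-position k s t t≡
... | u , toℕ-u , t≡′ =
  ℕP.<-trans (decreasing-by-adjacent f lo hi step k u t lo≤u t≤hi t≡′) (step s u lo≤s u≤hi toℕ-u)
  where
  lo≤u : lo ≤ toℕ u
  lo≤u = subst (lo ≤_) (sym toℕ-u) (ℕP.≤-trans lo≤s (ℕP.n≤1+n _))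
  u≤hi : toℕ u ≤ hi
  u≤hi = ℕP.≤-trans (ℕP.<⇒≤ (next-position-< u t k t≡′)) t≤hi

module ReversedDecreasingBlock {n : ℕ} (w : Perm n) (lo L : ℕ) .(hi<n : lo + L < n) (1≤L : 1 ≤ L)
  (decreasing : BlockReversal.DecreasingOnBlock {n} lo L hi<n w)
  (w[lo-1]<w[hi] : ∀ (s t : Fin n) → suc (toℕ s) ≡ lo → toℕ t ≡ lo + L → w ⟨$⟩ʳ s Fin.< w ⟨$⟩ʳ t)
  (w[lo]<w[hi+1] : ∀ (s t : Fin n) → toℕ s ≡ lo → toℕ t ≡ suc (lo + L) → w ⟨$⟩ʳ s Fin.< w ⟨$⟩ʳ t) where

  open BlockReversal {n} lo L hi<n

  p : Perm n
  p = reverseBlock w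

  p≤w : p ≤W w
  p≤w = reverseBlock-≤W w decreasing

  module _ (r : ℕ) .(r+1<n : suc r < n) (lo≤r : lo ≤ r) (r<hi : r < hi) where
    open AdjacentSwap w r r+1<n using (Descent; w[r]; w[r+1]; r<n; pos-w[r]; pos-w[r+1])

    private
      r-InBlock : InBlock r
      r-InBlock = lo≤r , ℕP.<⇒≤ r<hi

      r+1-InBlock : InBlock (suc r)
      r+1-InBlock = ℕP.≤-trans lo≤r (ℕP.n≤1+n r) , r<hi

    descent-inBlock : Descent
    descent-inBlock = decreasing (fromℕ< r<n) (fromℕ< r+1<n)
      (subst InBlock (sym (toℕ-fromℕ< r<n)) r-InBlock) (subst InBlock (sym (toℕ-fromℕ< r+1<n)) r+1-InBlock)
      (subst₂ _<_ (sym (toℕ-fromℕ< r<n)) (sym (toℕ-fromℕ< r+1<n)) (ℕP.n<1+n r))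

    descent-inBlock-BothInBlock : BothInBlock w w[r+1] w[r]
    descent-inBlock-BothInBlock = subst InBlock (sym pos-w[r+1]) r+1-InBlock , subst InBlock (sym pos-w[r]) r-InBlock

    ≤W-swap⇒descent-inBlock-kept : ∀ z → z ≤W AdjacentSwap.swap w r r+1<n → pos z w[r+1] < pos z w[r]
    ≤W-swap⇒descent-inBlock-kept z z≤swap =
      ¬Inversion⇒pos-< z descent-inBlock (AdjacentSwap.≤W-swap⇒¬inversion w r r+1<n descent-inBlock z z≤swap)

  swapAt : (r : ℕ) → .(suc r < n) → Perm n
  swapAt r r+1<n = AdjacentSwap.swap w r r+1<n

  swapAt-cong : ∀ {r r′} → r ≡ r′ → .(h : suc r < n) .(h′ : suc r′ < n) → swapAt r h ≡ swapAt r′ h′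
  swapAt-cong refl _ _ = refl

  private
    offset<hi : (j : Fin L) → lo + toℕ j < hi
    offset<hi j = ℕP.+-monoʳ-< lo (toℕ<n j)

    offset+1<n : (j : Fin L) → suc (lo + toℕ j) < n
    offset+1<n j = recompute (_ <? n) (ℕP.≤-<-trans (offset<hi j) hi<n)

  blockSwaps : List (Perm n)
  blockSwaps = List.tabulate {n = L} λ j → swapAt (lo + toℕ j) (offset+1<n j)

  blockSwaps-⋖ : All (_⋖ w) blockSwaps
  blockSwaps-⋖ = AllP.tabulate⁺ λ j → let r = lo + toℕ j in
    AdjacentSwap.swap-⋖ w r (offset+1<n j) (descent-inBlock r (offset+1<n j) (ℕP.m≤m+n lo _) (offset<hi j))

  p≤blockSwaps : All (p ≤W_) blockSwaps
  p≤blockSwaps = AllP.tabulate⁺ λ j → let r = lo + toℕ j; lo≤r = ℕP.m≤m+n lo (toℕ j) in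
    AdjacentSwap.≤W-swap w r (offset+1<n j) (descent-inBlock r (offset+1<n j) lo≤r (offset<hi j)) p p≤w
      λ inv → proj₂ (reverseBlock-inversion⁻ w decreasing inv)
                    (descent-inBlock-BothInBlock r (offset+1<n j) lo≤r (offset<hi j))

  ≤blockSwaps⇒≤swapAt : ∀ z → All (z ≤W_) blockSwaps →
    ∀ r .(r+1<n : suc r < n) → lo ≤ r → r < hi → z ≤W swapAt r r+1<n
  ≤blockSwaps⇒≤swapAt z z≤swaps r r+1<n lo≤r r<hi =
    subst (z ≤W_) (swapAt-cong lo+j≡r (offset+1<n j) r+1<n) (AllP.tabulate⁻ z≤swaps j)
    where
    r∸lo<L : r ∸ lo < L
    r∸lo<L = subst (r ∸ lo <_) (ℕP.m+n∸m≡n lo L) (ℕP.∸-monoˡ-< r<hi lo≤r)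
    j = fromℕ< r∸lo<L
    lo+j≡r : lo + toℕ j ≡ r
    lo+j≡r = trans (cong (lo +_) (toℕ-fromℕ< r∸lo<L)) (ℕP.m+[n∸m]≡n lo≤r)

  ≤blockSwaps⇒adjacent-reversed : ∀ z → All (z ≤W_) blockSwaps →
    ∀ s t → lo ≤ toℕ s → toℕ t ≤ hi → toℕ t ≡ suc (toℕ s) →
    pos z (w ⟨$⟩ʳ t) < pos z (w ⟨$⟩ʳ s)
  ≤blockSwaps⇒adjacent-reversed z z≤swaps s t lo≤s t≤hi t≡1+s =
      subst₂ (λ t′ s′ → pos z (w ⟨$⟩ʳ t′) < pos z (w ⟨$⟩ʳ s′))
        (toℕ-injective (trans (toℕ-fromℕ< s+1<n) (sym t≡1+s))) (FinP.fromℕ<-toℕ s (toℕ<n s))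
        (≤W-swap⇒descent-inBlock-kept (toℕ s) s+1<n lo≤s s<hi z
          (≤blockSwaps⇒≤swapAt z z≤swaps (toℕ s) s+1<n lo≤s s<hi))
      where
      s+1<n : suc (toℕ s) < n
      s+1<n = subst (_< n) t≡1+s (toℕ<n t)
      s<hi : toℕ s < hi
      s<hi = subst (_≤ hi) t≡1+s t≤hi

  ≤blockSwaps⇒≤W-p : ∀ z → z ≤W w → All (z ≤W_) blockSwaps → z ≤W p
  ≤blockSwaps⇒≤W-p z z≤w z≤swaps a b iz =
    case BothInBlock? w a b of λ where
      (no ¬ab) → reverseBlock-inversion-outside⁺ w ¬ab (z≤w a b iz)
      (yes ab) → ⊥-elim (ℕP.<-asym (proj₂ iz) (a-before-b ab))
    where
    a-before-b : BothInBlock w a b → pos z a < pos z b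
    a-before-b (ia , ib) = subst₂ (λ a′ b′ → pos z a′ < pos z b′) (inverseʳ w) (inverseʳ w)
      (decreasing-by-adjacent (λ s → pos z (w ⟨$⟩ʳ s)) lo hi (≤blockSwaps⇒adjacent-reversed z z≤swaps)
        (pos w a ∸ suc (pos w b)) (w ⟨$⟩ˡ b) (w ⟨$⟩ˡ a) (proj₁ ib) (proj₂ ia)
        (sym (ℕP.m+[n∸m]≡n (proj₂ (z≤w a b iz)))))

  private
    reflectFin-outside : ∀ s → ¬ InBlock (toℕ s) → reflectFin s ≡ s
    reflectFin-outside s ¬b = toℕ-injective (trans (toℕ-reflectFin s) (reflect-outside ¬b))

  -- p is increasing on the block and, by w[lo-1]<w[hi] and w[lo]<w[hi+1], across its two ends.
  descent-p-outsideBlock : ∀ r .(r+1<n : suc r < n) → AdjacentSwap.Descent p r r+1<n →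
    ¬ InBlock r × ¬ InBlock (suc r)
  descent-p-outsideBlock r r+1<n desc = cases (InBlock? r) (InBlock? (suc r))
    where
    open AdjacentSwap p r r+1<n using (r<n)
    s = fromℕ< r<n
    t = fromℕ< r+1<n
    toℕ-s : toℕ s ≡ r
    toℕ-s = toℕ-fromℕ< r<n
    toℕ-t : toℕ t ≡ suc r
    toℕ-t = toℕ-fromℕ< r+1<n
    toℕ-reflect-s : toℕ (reflectFin s) ≡ reflect r
    toℕ-reflect-s = trans (toℕ-reflectFin s) (cong reflect toℕ-s)
    toℕ-reflect-t : toℕ (reflectFin t) ≡ reflect (suc r)
    toℕ-reflect-t = trans (toℕ-reflectFin t) (cong reflect toℕ-t)

    cases : Dec (InBlock r) → Dec (InBlock (suc r)) → ¬ InBlock r × ¬ InBlock (suc r)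
    cases (no ¬ir) (no ¬ir+1) = ¬ir , ¬ir+1
    cases (yes ir) (yes ir+1) = ⊥-elim (ℕP.<-asym desc (decreasing (reflectFin t) (reflectFin s)
      (subst InBlock (sym toℕ-reflect-t) (reflect-InBlock ir+1))
      (subst InBlock (sym toℕ-reflect-s) (reflect-InBlock ir))
      (subst₂ _<_ (sym toℕ-reflect-t) (sym toℕ-reflect-s) (reflect-antitone-inside ir+1 ir (ℕP.n<1+n r)))))
    cases (no ¬ir) (yes ir+1) =
      let r+1≡lo = ℕP.≤-antisym (ℕP.≰⇒> λ lo≤r → ¬ir (lo≤r , ℕP.≤-trans (ℕP.n≤1+n r) (proj₂ ir+1)))
                     (proj₁ ir+1)
          toℕ-s≡lo-1 = trans (cong suc toℕ-s) r+1≡lo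
      in ⊥-elim (ℕP.<-asym desc (subst (λ s′ → w ⟨$⟩ʳ s′ Fin.< w ⟨$⟩ʳ reflectFin t)
           (sym (reflectFin-outside s (subst (¬_ ∘ InBlock) (sym toℕ-s) ¬ir)))
           (w[lo-1]<w[hi] s (reflectFin t) toℕ-s≡lo-1
             (trans toℕ-reflect-t (trans (cong reflect r+1≡lo) reflect-lo)))))
    cases (yes ir) (no ¬ir+1) =
      let r≡hi = ℕP.≤-antisym (proj₂ ir)
                   (ℕP.≤-pred (ℕP.≰⇒> λ r+1≤hi → ¬ir+1 (ℕP.≤-trans (proj₁ ir) (ℕP.n≤1+n r) , r+1≤hi)))
      in ⊥-elim (ℕP.<-asym desc (subst (λ t′ → w ⟨$⟩ʳ reflectFin s Fin.< w ⟨$⟩ʳ t′)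
           (sym (reflectFin-outside t (subst (¬_ ∘ InBlock) (sym toℕ-t) ¬ir+1)))
           (w[lo]<w[hi+1] (reflectFin s) t (trans toℕ-reflect-s (trans (cong reflect r≡hi) reflect-hi))
             (trans toℕ-t (cong suc r≡hi)))))

  module _ (r : ℕ) .(r+1<n : suc r < n) (desc-p : AdjacentSwap.Descent p r r+1<n) where
    private
      module Sp = AdjacentSwap p r r+1<n
      module Sw = AdjacentSwap w r r+1<n
      outside = descent-p-outsideBlock r r+1<n desc-p

    p[r]≡w[r] : Sp.w[r] ≡ Sw.w[r]
    p[r]≡w[r] = cong (w ⟨$⟩ʳ_) (reflectFin-outside (fromℕ< Sp.r<n)
      (subst (¬_ ∘ InBlock) (sym (toℕ-fromℕ< Sp.r<n)) (proj₁ outside)))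

    p[r+1]≡w[r+1] : Sp.w[r+1] ≡ Sw.w[r+1]
    p[r+1]≡w[r+1] = cong (w ⟨$⟩ʳ_) (reflectFin-outside (fromℕ< r+1<n)
      (subst (¬_ ∘ InBlock) (sym (toℕ-fromℕ< r+1<n)) (proj₂ outside)))

    descent-w : Sw.Descent
    descent-w = subst₂ Fin._<_ p[r+1]≡w[r+1] p[r]≡w[r] desc-p

    ≤W-swap-w⇒≤W-swap-p : ∀ z → z ≤W p → z ≤W Sw.swap → z ≤W Sp.swap
    ≤W-swap-w⇒≤W-swap-p z z≤p z≤swap-w = Sp.≤W-swap desc-p z z≤p
      (subst₂ (λ a b → ¬ Inversion z a b) (sym p[r+1]≡w[r+1]) (sym p[r]≡w[r])
        (Sw.≤W-swap⇒¬inversion descent-w z z≤swap-w))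

    ≤W-swap-p⇒≤W-swap-w : ∀ c → c ≤W p → c ≤W Sp.swap → c ≤W Sw.swap
    ≤W-swap-p⇒≤W-swap-w c c≤p c≤swap-p = Sw.≤W-swap descent-w c (≤W-trans c p w c≤p p≤w)
      (subst₂ (λ a b → ¬ Inversion c a b) p[r+1]≡w[r+1] p[r]≡w[r] (Sp.≤W-swap⇒¬inversion desc-p c c≤swap-p))

  -- A cover of p swaps a descent of p outside the block, which is also a descent of w.
  partner : ∀ c → c ⋖ p → CoverPartner w p c
  partner c c⋖p = fromSwap (⋖⇒swap c p c⋖p)
    where
    fromSwap : (∃ λ r → Σ (suc r < n) λ r+1<n →
      let open AdjacentSwap p r r+1<n in Descent × (c ≤W swap) × (swap ≤W c)) → CoverPartner w p c
    fromSwap (r , r+1<n , desc-p , c≤swap-p , swap-p≤c) =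
      AdjacentSwap.swap w r r+1<n ,
      AdjacentSwap.swap-⋖ w r r+1<n (descent-w r r+1<n desc-p) ,
      ≤W-swap-p⇒≤W-swap-w r r+1<n desc-p c (proj₁ c⋖p) c≤swap-p ,
      λ z z≤p z≤q → ≤W-trans z (AdjacentSwap.swap p r r+1<n) c
        (≤W-swap-w⇒≤W-swap-p r r+1<n desc-p z z≤p z≤q) swap-p≤c

  w≰p : ¬ (w ≤W p)
  w≰p w≤p = proj₂ (reverseBlock-inversion⁻ w decreasing (w≤p _ _ (S.descent-inversion desc)))
                  (descent-inBlock-BothInBlock lo lo+1<n ℕP.≤-refl lo<hi)
    where
    lo<hi : lo < hi
    lo<hi = subst (_≤ hi) (ℕP.+-comm lo 1) (ℕP.+-monoʳ-≤ lo 1≤L)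
    lo+1<n : suc lo < n
    lo+1<n = recompute (_ <? n) (ℕP.≤-<-trans lo<hi hi<n)
    module S = AdjacentSwap w lo lo+1<n
    desc = descent-inBlock lo lo+1<n ℕP.≤-refl lo<hi

  w↦p : Move w p
  w↦p = (blockSwaps , blockSwaps-⋖ , p≤w , p≤blockSwaps , ≤blockSwaps⇒≤W-p) ,
        λ p≈w → w≰p (≤W-resp-≈P p w p p p≈w (≈P-refl p) (≤W-refl p))

  atnissWin : AtnissWin w
  atnissWin = strategy-stealing w p w↦p
    (moves-lift w p blockSwaps blockSwaps-⋖ (p≤w , p≤blockSwaps , ≤blockSwaps⇒≤W-p) w≰p partner)

word-toℕ : (w : Perm n) (s : Fin n) → word w (toℕ s) ≡ toℕ (w ⟨$⟩ʳ s)
word-toℕ {n} w s with toℕ s <? n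
... | yes s<n = cong (λ t → toℕ (w ⟨$⟩ʳ t)) (FinP.fromℕ<-toℕ s s<n)
... | no s≮n  = ⊥-elim (s≮n (toℕ<n s))

stdFactor-<⁻ : (w : Perm n) (i k : ℕ) (a b : Fin k) → stdFactor w i k a < stdFactor w i k b →
  word w (i + toℕ a) < word w (i + toℕ b)
stdFactor-<⁻ w i k a b lt with word w (i + toℕ a) <? word w (i + toℕ b)
... | yes wa<wb = wa<wb
... | no wa≮wb = ⊥-elim (ℕP.<⇒≱ lt (length-filter-mono
  (λ c → word w (i + toℕ c) <? word w (i + toℕ b)) (λ c → word w (i + toℕ c) <? word w (i + toℕ a))
  (λ c lt′ → ℕP.<-≤-trans lt′ (ℕP.≮⇒≥ wa≮wb)) (allFin k)))

bPat-middle : ∀ k (a : Fin (4 + k)) p → toℕ a ≡ suc p → p < 2 + k → bPat (4 + k) a ≡ (2 + k) ∸ p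
bPat-middle k (Fin.suc a) p a≡ p<2+k with suc (toℕ a) ℕ.≟ 3 + k
... | yes a≡last = ⊥-elim (ℕP.<-irrefl (trans (sym (ℕP.suc-injective a≡)) (ℕP.suc-injective a≡last)) p<2+k)
... | no _ = cong ((2 + k) ∸_) (ℕP.suc-injective a≡)

bPat-last : ∀ k (a : Fin (4 + k)) → toℕ a ≡ 3 + k → bPat (4 + k) a ≡ 3 + k
bPat-last k (Fin.suc a) a≡ with suc (toℕ a) ℕ.≟ 3 + k
... | yes _ = refl
... | no a≢last = ⊥-elim (a≢last a≡)

-- The occurrence of bPat (4 + k) starts at position i; its middle block is [i + 1, i + 2 + k].
module PatternOccurrence (k : ℕ) {n : ℕ} (w : Perm n) (i : ℕ) (i+m≤n : i + (4 + k) ≤ n)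
  (std≡bPat : ∀ a → stdFactor w i (4 + k) a ≡ bPat (4 + k) a) where

  ordered-like-bPat : (oa ob : Fin (4 + k)) (s t : Fin n) → i + toℕ oa ≡ toℕ s → i + toℕ ob ≡ toℕ t →
    bPat (4 + k) oa < bPat (4 + k) ob → w ⟨$⟩ʳ s Fin.< w ⟨$⟩ʳ t
  ordered-like-bPat oa ob s t s≡ t≡ lt =
    subst₂ _<_ (trans (cong (word w) s≡) (word-toℕ w s)) (trans (cong (word w) t≡) (word-toℕ w t))
      (stdFactor-<⁻ w i (4 + k) oa ob (subst₂ _<_ (sym (std≡bPat oa)) (sym (std≡bPat ob)) lt))

  lo L : ℕ
  lo = suc i
  L = suc k

  hi<n : lo + L < n
  hi<n = ℕP.<-≤-trans (subst (_< i + (4 + k)) (ℕP.+-suc i (suc k))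
    (ℕP.+-monoʳ-< i (ℕP.<-trans (ℕP.n<1+n (2 + k)) (ℕP.n<1+n (3 + k))))) i+m≤n

  private
    blockOffset : (s : Fin n) → BlockReversal.InBlock {n} lo L hi<n (toℕ s) →
      Σ ℕ λ p → (p < 2 + k) × (i + suc p ≡ toℕ s)
    blockOffset s (lo≤s , s≤hi) =
      toℕ s ∸ lo ,
      s≤s (subst (toℕ s ∸ lo ≤_) (ℕP.m+n∸m≡n lo L) (ℕP.∸-monoˡ-≤ lo s≤hi)) ,
      trans (ℕP.+-suc i _) (ℕP.m+[n∸m]≡n lo≤s)

    middle<m : ∀ {p} → p < 2 + k → suc p < 4 + k
    middle<m p<2+k = s≤s (ℕP.<-trans p<2+k (ℕP.n<1+n _))

  decreasing : BlockReversal.DecreasingOnBlock {n} lo L hi<n w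
  decreasing s t is it s<t =
    let pa , pa<2+k , s≡ = blockOffset s is
        pb , pb<2+k , t≡ = blockOffset t it
        pa<pb = ℕP.+-cancelˡ-< i pa pb (ℕP.≤-pred (subst₂ _<_ (sym (trans (sym (ℕP.+-suc i pa)) s≡))
                                                               (sym (trans (sym (ℕP.+-suc i pb)) t≡)) s<t))
        a<m = middle<m pa<2+k
        b<m = middle<m pb<2+k
    in ordered-like-bPat (fromℕ< b<m) (fromℕ< a<m) t s
         (trans (cong (i +_) (toℕ-fromℕ< b<m)) t≡) (trans (cong (i +_) (toℕ-fromℕ< a<m)) s≡)
         (subst₂ _<_ (sym (bPat-middle k _ pb (toℕ-fromℕ< b<m) pb<2+k))
                     (sym (bPat-middle k _ pa (toℕ-fromℕ< a<m) pa<2+k))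
           (ℕP.∸-monoʳ-< pa<pb (ℕP.<⇒≤ pb<2+k)))

  w[lo-1]<w[hi] : ∀ (s t : Fin n) → suc (toℕ s) ≡ lo → toℕ t ≡ lo + L → w ⟨$⟩ʳ s Fin.< w ⟨$⟩ʳ t
  w[lo-1]<w[hi] s t s≡ t≡ =
    ordered-like-bPat Fin.zero (fromℕ< 2+k<m) s t
      (trans (ℕP.+-identityʳ i) (sym (ℕP.suc-injective s≡)))
      (trans (cong (i +_) (toℕ-fromℕ< 2+k<m)) (trans (ℕP.+-suc i (suc k)) (sym t≡)))
      (subst (0 <_) (sym (trans (bPat-middle k _ (suc k) (toℕ-fromℕ< 2+k<m) (ℕP.n<1+n _))
                                (ℕP.m+n∸n≡m 1 (suc k))))
        (s≤s z≤n))
    where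
    2+k<m : 2 + k < 4 + k
    2+k<m = ℕP.<-trans (ℕP.n<1+n (2 + k)) (ℕP.n<1+n (3 + k))

  w[lo]<w[hi+1] : ∀ (s t : Fin n) → toℕ s ≡ lo → toℕ t ≡ suc (lo + L) → w ⟨$⟩ʳ s Fin.< w ⟨$⟩ʳ t
  w[lo]<w[hi+1] s t s≡ t≡ =
    ordered-like-bPat (Fin.suc Fin.zero) (Fin.fromℕ (3 + k)) s t
      (trans (ℕP.+-comm i 1) (sym s≡))
      (trans (cong (i +_) (FinP.toℕ-fromℕ (3 + k)))
        (trans (ℕP.+-suc i (2 + k)) (trans (cong suc (ℕP.+-suc i (suc k))) (sym t≡))))
      (subst₂ _<_ (sym (bPat-middle k _ 0 refl (s≤s z≤n))) (sym (bPat-last k _ (FinP.toℕ-fromℕ (3 + k))))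
        (ℕP.n<1+n (2 + k)))

  atnissWin : AtnissWin w
  atnissWin = ReversedDecreasingBlock.atnissWin w lo L hi<n (s≤s z≤n) decreasing w[lo-1]<w[hi] w[lo]<w[hi+1]

lemma3p1 : (n : ℕ) (w : Perm n) (m : ℕ) → 4 ≤ m →
    ConsContains w m (bPat m) → AtnissWin w
lemma3p1 n w (suc (suc (suc (suc k)))) (s≤s (s≤s (s≤s (s≤s _)))) (i , i+m≤n , std≡bPat) =
  PatternOccurrence.atnissWin k w i i+m≤n std≡bPat
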